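{- For every 2-functor $T:\mathcal V\text{ -cat}\to\mathcal V\text{ -cat}$ there is a one-to-one correspondence between relation liftings $\overline T:\mathcal V\text{ -mod}\to\mathcal V\text{ -mod}$ of $T$ and distributive laws $\delta:T\cdot\mathsf L\to\mathsf L\cdot T$ of $T$ over the 2-monad $(\mathsf L,y,m)$.
   Context: $\mathcal V=(\mathcal V_o,\otimes,I,[-,-])$ is a commutative quantale: $\mathcal V_o$ a complete lattice, $\otimes$ commutative associative with unit $I$ preserving joins in each variable, $x\otimes y\le z$ iff $y\le[x,z]$. $\mathcal V$-categories have hom-values $\mathcal A(a,b)\in\mathcal V_o$ with $I\le\mathcal A(a,a)$, $\mathcal A(b,c)\otimes\mathcal A(a,b)\le\mathcal A(a,c)$; $\mathcal V$-functors satisfy $\mathcal A(a,a')\le\mathcal B(fa,fa')$; $\mathcal A^{op}(a,b)=\mathcal A(b,a)$; $\mathcal A\otimes\mathcal B$ has homs $\mathcal A(a,a')\otimes\mathcal B(b,b')$; $f\le g$ iff $I\le\mathcal B(fa,ga)$ for all $a$. $\mathcal V\text{ -cat}$: 2-category of small $\mathcal V$-categories, $\mathcal V$-functors and $\le$; a 2-functor on it is a functor preserving $\le$. A module $R:\mathcal A\rightsquigarrow\mathcal B$ is a $\mathcal V$-functor $\mathcal B^{op}\otimes\mathcal A\to\mathcal V$; composition $(S\cdot R)(c,a)=\bigvee_bS(c,b)\otimes R(b,a)$, identities the hom-functors, pointwise order: this is the 2-category $\mathcal V\text{ -mod}$. The graph 2-functor $(-)_\diamond:\mathcal V\text{ -cat}\to\mathcal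 V\text{ -mod}$ is identity on objects and $f_\diamond(b,a)=\mathcal B(b,fa)$. A relation lifting of $T$ is a 2-functor $\overline T:\mathcal V\text{ -mod}\to\mathcal V\text{ -mod}$ with $\overline T\circ(-)_\diamond=(-)_\diamond\circ T$. The 2-monad $(\mathsf L,y,m)$ on $\mathcal V\text{ -cat}$: $\mathsf L\mathcal A=[\mathcal A^{op},\mathcal V]$ (functor category with homs $\bigwedge_a[\phi a,\psi a]$), $(\mathsf Lf)(\phi)(b)=\bigvee_a\phi(a)\otimes\mathcal B(b,fa)$, $y_{\mathcal A}(a)=\mathcal A(-,a)$, $m_{\mathcal A}(W)(a)=\bigvee_wW(w)\otimes w(a)$. A distributive law is a 2-natural transformation $\delta:T\mathsf L\to\mathsf LT$ with $\delta\cdot Ty=yT$ and $mT\cdot\mathsf L\delta\cdot\delta\mathsf L=\delta\cdot Tm$. -}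

module Defs where

open import Level using (Level; _⊔_; suc)
open import Data.Product using (Σ; _,_; proj₁; proj₂; _×_)
open import Relation.Binary.Bundles using (Setoid; Preorder)
open import Relation.Binary.PropositionalEquality as P using (_≡_)
open import Data.Product.Relation.Binary.Pointwise.NonDependent using (×-setoid)
import Relation.Binary.Reasoning.Preorder as PR

-- Commutative quantales  V = (V₀, ⊗, I, [-,-])
-- V₀ is a complete lattice (partial order w.r.t. ≡, with all joins
-- indexed by types of the same universe); ⊗ is commutative, associative,
-- has unit I, preserves joins in each variable (stated for the right
-- variable; by commutativity also for the left), and x ⊗ y ≤ z iff
-- y ≤ [x , z].

record Quantale (ℓ : Level) : Set (suc ℓ) where
  infixr 7 _⊗_
  infix 4 _≤_
  field
    Carrier   : Set ℓ
    _≤_       : Carrier → Carrier → Set ℓ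
    ≤-refl    : ∀ {x} → x ≤ x
    ≤-trans   : ∀ {x y z} → x ≤ y → y ≤ z → x ≤ z
    ≤-antisym : ∀ {x y} → x ≤ y → y ≤ x → x ≡ y
    ⋁         : {J : Set ℓ} → (J → Carrier) → Carrier
    ⋁-ub      : {J : Set ℓ} (f : J → Carrier) (j : J) → f j ≤ ⋁ f
    ⋁-lub     : {J : Set ℓ} (f : J → Carrier) {x : Carrier} →
                (∀ j → f j ≤ x) → ⋁ f ≤ x
    _⊗_       : Carrier → Carrier → Carrier
    I         : Carrier
    ⊗-assoc   : ∀ x y z → (x ⊗ y) ⊗ z ≡ x ⊗ (y ⊗ z)
    ⊗-comm    : ∀ x y → x ⊗ y ≡ y ⊗ x
    ⊗-unitˡ   : ∀ x → I ⊗ x ≡ x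
    ⊗-⋁       : ∀ x {J : Set ℓ} (f : J → Carrier) → x ⊗ ⋁ f ≡ ⋁ (λ j → x ⊗ f j)
    [_,_]     : Carrier → Carrier → Carrier
    curry     : ∀ {x y z} → x ⊗ y ≤ z → y ≤ [ x , z ]
    uncurry   : ∀ {x y z} → y ≤ [ x , z ] → x ⊗ y ≤ z

  ⋀ : {J : Set ℓ} → (J → Carrier) → Carrier
  ⋀ {J} f = ⋁ {Σ Carrier (λ x → ∀ j → x ≤ f j)} proj₁

  ⋀-lb : {J : Set ℓ} (f : J → Carrier) (j : J) → ⋀ f ≤ f j
  ⋀-lb f j = ⋁-lub proj₁ (λ p → proj₂ p j)

  ⋀-glb : {J : Set ℓ} (f : J → Carrier) {x : Carrier} → (∀ j → x ≤ f j) → x ≤ ⋀ f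
  ⋀-glb f {x} p = ⋁-ub proj₁ (x , p)

  ≡⇒≤ : ∀ {x y} → x ≡ y → x ≤ y
  ≡⇒≤ P.refl = ≤-refl

  preorder : Preorder ℓ ℓ ℓ
  preorder = record
    { Carrier = Carrier ; _≈_ = _≡_ ; _≲_ = _≤_
    ; isPreorder = record
      { isEquivalence = P.isEquivalence ; reflexive = ≡⇒≤ ; trans = ≤-trans } }

  module ≤-R = PR preorder

  ⊗-monoʳ : ∀ {x y y'} → y ≤ y' → x ⊗ y ≤ x ⊗ y'
  ⊗-monoʳ p = uncurry (≤-trans p (curry ≤-refl))

  ⊗-monoˡ : ∀ {x x' y} → x ≤ x' → x ⊗ y ≤ x' ⊗ y
  ⊗-monoˡ {x} {x'} {y} p =
    ≤-trans (≡⇒≤ (⊗-comm x y)) (≤-trans (⊗-monoʳ p) (≡⇒≤ (⊗-comm y x')))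

  ⊗-mono : ∀ {x x' y y'} → x ≤ x' → y ≤ y' → x ⊗ y ≤ x' ⊗ y'
  ⊗-mono p q = ≤-trans (⊗-monoˡ p) (⊗-monoʳ q)

  ev : ∀ {x z} → x ⊗ [ x , z ] ≤ z
  ev = uncurry ≤-refl

  ⊗-unitʳ : ∀ x → x ⊗ I ≡ x
  ⊗-unitʳ x = P.trans (⊗-comm x I) (⊗-unitˡ x)

  ⋁-cong : {J : Set ℓ} {f g : J → Carrier} → (∀ j → f j ≡ g j) → ⋁ f ≡ ⋁ g
  ⋁-cong {f = f} {g} e =
    ≤-antisym (⋁-lub f (λ j → ≤-trans (≡⇒≤ (e j)) (⋁-ub g j)))
              (⋁-lub g (λ j → ≤-trans (≡⇒≤ (P.sym (e j))) (⋁-ub f j)))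

  ⋀-cong : {J : Set ℓ} {f g : J → Carrier} → (∀ j → f j ≡ g j) → ⋀ f ≡ ⋀ g
  ⋀-cong {f = f} {g} e =
    ≤-antisym (⋀-glb g (λ j → ≤-trans (⋀-lb f j) (≡⇒≤ (e j))))
              (⋀-glb f (λ j → ≤-trans (⋀-lb g j) (≡⇒≤ (P.sym (e j)))))

  ⋁⊗-lub : {J : Set ℓ} (f : J → Carrier) {x z : Carrier} →
           (∀ j → f j ⊗ x ≤ z) → ⋁ f ⊗ x ≤ z
  ⋁⊗-lub f {x} p = ≤-trans (≡⇒≤ (⊗-comm (⋁ f) x))
    (uncurry (⋁-lub f (λ j → curry (≤-trans (≡⇒≤ (⊗-comm x (f j))) (p j)))))

  ⊗⋁-lub : {J : Set ℓ} (f : J → Carrier) {x z : Carrier} →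
           (∀ j → x ⊗ f j ≤ z) → x ⊗ ⋁ f ≤ z
  ⊗⋁-lub f p = uncurry (⋁-lub f (λ j → curry (p j)))

  interchange : ∀ a b c d → (a ⊗ b) ⊗ (c ⊗ d) ≡ (a ⊗ c) ⊗ (b ⊗ d)
  interchange a b c d =
    P.trans (⊗-assoc a b (c ⊗ d))
   (P.trans (P.cong (a ⊗_) (P.sym (⊗-assoc b c d)))
   (P.trans (P.cong (λ u → a ⊗ (u ⊗ d)) (⊗-comm b c))
   (P.trans (P.cong (a ⊗_) (⊗-assoc c b d))
            (P.sym (⊗-assoc a c (b ⊗ d))))))

  I≤[x,x] : ∀ {x} → I ≤ [ x , x ]
  I≤[x,x] {x} = curry (≡⇒≤ (⊗-unitʳ x))

  [,]-comp : ∀ {x y z} → [ y , z ] ⊗ [ x , y ] ≤ [ x , z ]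
  [,]-comp {x} {y} {z} = curry (begin
      x ⊗ ([ y , z ] ⊗ [ x , y ])
        ≡⟨ P.cong (x ⊗_) (⊗-comm _ _) ⟩
      x ⊗ ([ x , y ] ⊗ [ y , z ])
        ≡⟨ P.sym (⊗-assoc _ _ _) ⟩
      (x ⊗ [ x , y ]) ⊗ [ y , z ]
        ≲⟨ ⊗-monoˡ ev ⟩
      y ⊗ [ y , z ]
        ≲⟨ ev ⟩
      z ∎)
    where open ≤-R

module Over {ℓ : Level} (V : Quantale ℓ) where
  open Quantale V

  private
    swapʳ : ∀ x y z → (x ⊗ y) ⊗ z ≡ (x ⊗ z) ⊗ y
    swapʳ x y z = P.trans (⊗-assoc x y z)
                 (P.trans (P.cong (x ⊗_) (⊗-comm y z)) (P.sym (⊗-assoc x z y)))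

  record VCat : Set (suc ℓ) where
    field
      Obj      : Setoid ℓ ℓ
    open Setoid Obj public using () renaming (Carrier to Ob; _≈_ to _≈ₒ_)
    field
      hom      : Ob → Ob → Carrier
      hom-resp : ∀ {a a' b b'} → a ≈ₒ a' → b ≈ₒ b' → hom a b ≡ hom a' b'
      hom-id   : ∀ a → I ≤ hom a a
      hom-comp : ∀ a b c → hom b c ⊗ hom a b ≤ hom a c

  open VCat public

  record VFunctor (A B : VCat) : Set ℓ where
    field
      map      : Ob A → Ob B
      map-resp : ∀ {a a'} → _≈ₒ_ A a a' → _≈ₒ_ B (map a) (map a')
      map-hom  : ∀ a a' → hom A a a' ≤ hom B (map a) (map a')

  open VFunctor public

  idF : ∀ {A} → VFunctor A A
  idF = record { map = λ a → a ; map-resp = λ p → p ; map-hom = λ _ _ → ≤-refl }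

  infixr 9 _∘F_
  _∘F_ : ∀ {A B C} → VFunctor B C → VFunctor A B → VFunctor A C
  g ∘F f = record
    { map = λ a → map g (map f a)
    ; map-resp = λ p → map-resp g (map-resp f p)
    ; map-hom = λ a a' → ≤-trans (map-hom f a a') (map-hom g (map f a) (map f a')) }

  infix 4 _≐F_ _≤F_
  _≐F_ : ∀ {A B} → VFunctor A B → VFunctor A B → Set ℓ
  _≐F_ {A} {B} f g = ∀ a → _≈ₒ_ B (map f a) (map g a)

  _≤F_ : ∀ {A B} → VFunctor A B → VFunctor A B → Set ℓ
  _≤F_ {A} {B} f g = ∀ a → I ≤ hom B (map f a) (map g a)

  𝒱 : VCat
  𝒱 = record
    { Obj = P.setoid Carrier
    ; hom = [_,_]
    ; hom-resp = λ p q → P.cong₂ [_,_] p q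
    ; hom-id = λ _ → I≤[x,x]
    ; hom-comp = λ _ _ _ → [,]-comp }

  op : VCat → VCat
  op A = record
    { Obj = Obj A
    ; hom = λ a b → hom A b a
    ; hom-resp = λ p q → hom-resp A q p
    ; hom-id = hom-id A
    ; hom-comp = λ a b c →
        ≤-trans (≡⇒≤ (⊗-comm (hom A c b) (hom A b a))) (hom-comp A c b a) }

  infixr 6 _⊠_
  _⊠_ : VCat → VCat → VCat
  A ⊠ B = record
    { Obj = ×-setoid (Obj A) (Obj B)
    ; hom = λ p q → hom A (proj₁ p) (proj₁ q) ⊗ hom B (proj₂ p) (proj₂ q)
    ; hom-resp = λ p q → P.cong₂ _⊗_ (hom-resp A (proj₁ p) (proj₁ q))
                                     (hom-resp B (proj₂ p) (proj₂ q))
    ; hom-id = λ p → ≤-trans (≡⇒≤ (P.sym (⊗-unitˡ I)))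
                             (⊗-mono (hom-id A (proj₁ p)) (hom-id B (proj₂ p)))
    ; hom-comp = λ p q r →
        ≤-trans (≡⇒≤ (interchange _ _ _ _))
                (⊗-mono (hom-comp A (proj₁ p) (proj₁ q) (proj₁ r))
                        (hom-comp B (proj₂ p) (proj₂ q) (proj₂ r))) }

  infix 5 _⇝_
  _⇝_ : VCat → VCat → Set ℓ
  A ⇝ B = VFunctor (op B ⊠ A) 𝒱

  _⟨_,_⟩ : ∀ {A B} → A ⇝ B → Ob B → Ob A → Carrier
  R ⟨ b , a ⟩ = map R (b , a)

  infix 4 _≐ₘ_ _≤ₘ_
  _≐ₘ_ : ∀ {A B} → A ⇝ B → A ⇝ B → Set ℓ
  _≐ₘ_ {A} {B} R S = ∀ b a → R ⟨ b , a ⟩ ≡ S ⟨ b , a ⟩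

  _≤ₘ_ : ∀ {A B} → A ⇝ B → A ⇝ B → Set ℓ
  _≤ₘ_ {A} {B} R S = ∀ b a → R ⟨ b , a ⟩ ≤ S ⟨ b , a ⟩

  private
    mkMod : ∀ {A B} (R : Ob B → Ob A → Carrier) →
      (∀ {b b' a a'} → _≈ₒ_ B b b' → _≈ₒ_ A a a' → R b a ≡ R b' a') →
      (∀ {b b' a} → hom B b' b ⊗ R b a ≤ R b' a) →
      (∀ {b a a'} → R b a ⊗ hom A a a' ≤ R b a') → A ⇝ B
    mkMod {A} {B} R resp actL actR = record
      { map = λ p → R (proj₁ p) (proj₂ p)
      ; map-resp = λ p → resp (proj₁ p) (proj₂ p)
      ; map-hom = λ p q → curry
          (≤-trans (≡⇒≤ (P.trans (P.sym (⊗-assoc _ _ _))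
                                 (P.cong (_⊗ hom A (proj₂ p) (proj₂ q)) (⊗-comm _ _))))
                   (≤-trans (⊗-monoˡ actL) actR)) }

  homM : ∀ A → A ⇝ A
  homM A = mkMod (hom A) (hom-resp A)
    (λ {b} {b'} {a} → ≤-trans (≡⇒≤ (⊗-comm _ _)) (hom-comp A b' b a))
    (λ {b} {a} {a'} → ≤-trans (≡⇒≤ (⊗-comm _ _)) (hom-comp A b a a'))

  infixr 9 _·_
  _·_ : ∀ {A B C} → B ⇝ C → A ⇝ B → A ⇝ C
  _·_ {A} {B} {C} S R = mkMod (λ c a → ⋁ {Ob B} (λ b → S ⟨ c , b ⟩ ⊗ R ⟨ b , a ⟩))
    (λ p q → ⋁-cong (λ b → P.cong₂ _⊗_ (map-resp S (p , Setoid.refl (Obj B)))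
                                       (map-resp R (Setoid.refl (Obj B) , q))))
    (λ {c} {c'} {a} → ⊗⋁-lub _ (λ b →
       ≤-trans (≡⇒≤ (P.sym (⊗-assoc _ _ _)))
      (≤-trans (⊗-monoˡ (Sˡ {c} {c'} {b}))
               (⋁-ub (λ b → S ⟨ c' , b ⟩ ⊗ R ⟨ b , a ⟩) b))))
    (λ {c} {a} {a'} → ⋁⊗-lub _ (λ b →
       ≤-trans (≡⇒≤ (⊗-assoc _ _ _))
      (≤-trans (⊗-monoʳ (Rʳ {b} {a} {a'}))
               (⋁-ub (λ b → S ⟨ c , b ⟩ ⊗ R ⟨ b , a' ⟩) b))))
    where
      Sˡ : ∀ {c c' b} → hom C c' c ⊗ S ⟨ c , b ⟩ ≤ S ⟨ c' , b ⟩
      Sˡ {c} {c'} {b} =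
        ≤-trans (≡⇒≤ (P.trans (⊗-comm _ _) (P.sym (P.cong (S ⟨ c , b ⟩ ⊗_) (⊗-unitʳ _)))))
                (uncurry (≤-trans (⊗-monoʳ (hom-id B b)) (map-hom S (c , b) (c' , b))))
      Rʳ : ∀ {b a a'} → R ⟨ b , a ⟩ ⊗ hom A a a' ≤ R ⟨ b , a' ⟩
      Rʳ {b} {a} {a'} =
        ≤-trans (≡⇒≤ (P.cong (R ⟨ b , a ⟩ ⊗_) (P.sym (⊗-unitˡ _))))
                (uncurry (≤-trans (⊗-monoˡ (hom-id B b)) (map-hom R (b , a) (b , a'))))

  _⋄ : ∀ {A B} → VFunctor A B → A ⇝ B
  _⋄ {A} {B} f = mkMod (λ b a → hom B b (map f a))
    (λ p q → hom-resp B p (map-resp f q))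
    (λ {b} {b'} {a} → ≤-trans (≡⇒≤ (⊗-comm _ _)) (hom-comp B b' b (map f a)))
    (λ {b} {a} {a'} → ≤-trans (⊗-monoʳ (map-hom f a a'))
                     (≤-trans (≡⇒≤ (⊗-comm _ _)) (hom-comp B b (map f a) (map f a'))))

  Psh : VCat → Set ℓ
  Psh A = VFunctor (op A) 𝒱

  private
    mkPsh : ∀ {A} (φ : Ob A → Carrier) →
      (∀ {a a'} → _≈ₒ_ A a a' → φ a ≡ φ a') →
      (∀ {a a'} → φ a ⊗ hom A a' a ≤ φ a') → Psh A
    mkPsh φ resp act = record
      { map = φ ; map-resp = resp ; map-hom = λ a a' → curry act }

    pshAct : ∀ {A} (φ : Psh A) {a a'} → map φ a ⊗ hom A a' a ≤ map φ a'
    pshAct φ {a} {a'} = uncurry (map-hom φ a a')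

  L : VCat → VCat
  L A = record
    { Obj = record
      { Carrier = Psh A
      ; _≈_ = λ φ ψ → ∀ a → map φ a ≡ map ψ a
      ; isEquivalence = record
        { refl = λ _ → P.refl
        ; sym = λ e a → P.sym (e a)
        ; trans = λ e e' a → P.trans (e a) (e' a) } }
    ; hom = λ φ ψ → ⋀ {Ob A} (λ a → [ map φ a , map ψ a ])
    ; hom-resp = λ e e' → ⋀-cong (λ a → P.cong₂ [_,_] (e a) (e' a))
    ; hom-id = λ φ → ⋀-glb _ (λ a → I≤[x,x])
    ; hom-comp = λ φ ψ χ → ⋀-glb _ (λ a →
        ≤-trans (⊗-mono (⋀-lb _ a) (⋀-lb _ a)) [,]-comp) }

  L₁ : ∀ {A B} → VFunctor A B → VFunctor (L A) (L B)
  L₁ {A} {B} f = record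
    { map = Lf
    ; map-resp = λ e b → ⋁-cong (λ a → P.cong (_⊗ hom B b (map f a)) (e a))
    ; map-hom = λ φ ψ → ⋀-glb _ (λ b → curry (⋁⊗-lub _ (λ a →
        ≤-trans (≡⇒≤ (swapʳ _ _ _))
       (≤-trans (⊗-monoˡ (≤-trans (⊗-monoʳ (⋀-lb _ a)) ev))
                (⋁-ub (λ a → map ψ a ⊗ hom B b (map f a)) a))))) }
    where
      Lf : Psh A → Psh B
      Lf φ = mkPsh (λ b → ⋁ {Ob A} (λ a → map φ a ⊗ hom B b (map f a)))
        (λ p → ⋁-cong (λ a → P.cong (map φ a ⊗_) (hom-resp B p (Setoid.refl (Obj B)))))
        (λ {b} {b'} → ⋁⊗-lub _ (λ a →
           ≤-trans (≡⇒≤ (⊗-assoc _ _ _))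
          (≤-trans (⊗-monoʳ (hom-comp B b' b (map f a)))
                   (⋁-ub (λ a → map φ a ⊗ hom B b' (map f a)) a))))

  y : ∀ A → VFunctor A (L A)
  y A = record
    { map = λ a → mkPsh (λ x → hom A x a)
        (λ p → hom-resp A p (Setoid.refl (Obj A)))
        (λ {x} {x'} → hom-comp A x' x a)
    ; map-resp = λ p x → hom-resp A (Setoid.refl (Obj A)) p
    ; map-hom = λ a a' → ⋀-glb _ (λ x → curry
        (≤-trans (≡⇒≤ (⊗-comm _ _)) (hom-comp A x a a'))) }

  m : ∀ A → VFunctor (L (L A)) (L A)
  m A = record
    { map = mW
    ; map-resp = λ e a → ⋁-cong (λ w → P.cong (_⊗ map w a) (e w))
    ; map-hom = λ W W' → ⋀-glb _ (λ a → curry (⋁⊗-lub _ (λ w →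
        ≤-trans (≡⇒≤ (swapʳ _ _ _))
       (≤-trans (⊗-monoˡ (≤-trans (⊗-monoʳ (⋀-lb _ w)) ev))
                (⋁-ub (λ w → map W' w ⊗ map w a) w))))) }
    where
      mW : Psh (L A) → Psh A
      mW W = mkPsh (λ a → ⋁ {Psh A} (λ w → map W w ⊗ map w a))
        (λ p → ⋁-cong (λ w → P.cong (map W w ⊗_) (map-resp w p)))
        (λ {a} {a'} → ⋁⊗-lub _ (λ w →
           ≤-trans (≡⇒≤ (⊗-assoc _ _ _))
          (≤-trans (⊗-monoʳ (pshAct w))
                   (⋁-ub (λ w → map W w ⊗ map w a') w))))

  -- 2-functors  T : V-cat → V-cat  (functors preserving ≤; since
  -- functor equality is a setoid, they also respect it)

  record TwoFunctor : Set (suc ℓ) where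
    field
      F₀     : VCat → VCat
      F₁     : ∀ {A B} → VFunctor A B → VFunctor (F₀ A) (F₀ B)
      F-cong : ∀ {A B} {f g : VFunctor A B} → f ≐F g → F₁ f ≐F F₁ g
      F-mono : ∀ {A B} {f g : VFunctor A B} → f ≤F g → F₁ f ≤F F₁ g
      F-id   : ∀ {A} → F₁ (idF {A}) ≐F idF {F₀ A}
      F-∘    : ∀ {A B C} (g : VFunctor B C) (f : VFunctor A B) →
               F₁ (g ∘F f) ≐F F₁ g ∘F F₁ f

  module _ (T : TwoFunctor) where
    open TwoFunctor T

    -- Relation liftings of T: 2-functors  T̄ : V-mod → V-mod  with
    -- T̄ ∘ (-)⋄ = (-)⋄ ∘ T.  On objects this condition forces T̄ A = T A,
    -- so only the action on modules is data.
    record RelationLifting : Set (suc ℓ) where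
      field
        T̄      : ∀ {A B} → A ⇝ B → F₀ A ⇝ F₀ B
        T̄-cong : ∀ {A B} {R S : A ⇝ B} → R ≐ₘ S → T̄ R ≐ₘ T̄ S
        T̄-mono : ∀ {A B} {R S : A ⇝ B} → R ≤ₘ S → T̄ R ≤ₘ T̄ S
        T̄-id   : ∀ {A} → T̄ (homM A) ≐ₘ homM (F₀ A)
        T̄-·    : ∀ {A B C} (S : B ⇝ C) (R : A ⇝ B) → T̄ (S · R) ≐ₘ T̄ S · T̄ R
        T̄-⋄    : ∀ {A B} (f : VFunctor A B) → T̄ (f ⋄) ≐ₘ (F₁ f) ⋄

    open RelationLifting public

    record DistributiveLaw : Set (suc ℓ) where
      field
        δ       : ∀ A → VFunctor (F₀ (L A)) (L (F₀ A))
        δ-nat   : ∀ {A B} (f : VFunctor A B) →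
                  δ B ∘F F₁ (L₁ f) ≐F L₁ (F₁ f) ∘F δ A
        δ-unit  : ∀ A → δ A ∘F F₁ (y A) ≐F y (F₀ A)
        δ-mult  : ∀ A → m (F₀ A) ∘F L₁ (δ A) ∘F δ (L A) ≐F δ A ∘F F₁ (m A)

    open DistributiveLaw public

    LiftingSetoid : Setoid (suc ℓ) (suc ℓ)
    LiftingSetoid = record
      { Carrier = RelationLifting
      ; _≈_ = λ U U' → ∀ {A B} (R : A ⇝ B) → T̄ U R ≐ₘ T̄ U' R
      ; isEquivalence = record
        { refl = λ R b a → P.refl
        ; sym = λ e R b a → P.sym (e R b a)
        ; trans = λ e e' R b a → P.trans (e R b a) (e' R b a) } }

    DistributiveLawSetoid : Setoid (suc ℓ) (suc ℓ)
    DistributiveLawSetoid = record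
      { Carrier = DistributiveLaw
      ; _≈_ = λ D D' → ∀ A → δ D A ≐F δ D' A
      ; isEquivalence = record
        { refl = λ A X a → P.refl
        ; sym = λ e A X a → P.sym (e A X a)
        ; trans = λ e e' A X a → P.trans (e A X a) (e' A X a) } }

-- A module R : A ⇝ B is the same as a V-functor curry R : A → L B, and by Yoneda it
-- factors as R = ε · (curry R)⋄ through the evaluation module ε = evalₘ B : L B ⇝ B.
-- A lifting is therefore determined by its values T̄ ε, and δ := curry (T̄ ε) is a
-- distributive law: its axioms are T̄ applied to ε · (y A)⋄ = 1, ε · (L f)⋄ = f⋄ · ε and
-- ε · ε = ε · (m A)⋄.  Conversely δ gives T̄ R := uncurry (δ ∘ T (curry R)); preservation
-- of composites is the multiplication axiom, because composition of modules is Kleisli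
-- composition for L.
module Submission where

open import Level using (Level)
open import Data.Product using (_,_)
open import Function.Bundles using (Inverse)
open import Relation.Binary.Bundles using (Setoid)
open import Relation.Binary.PropositionalEquality using (_≡_; refl; sym; trans; cong; cong₂; module ≡-Reasoning)
open import Defs
open Defs.Over using (TwoFunctor; LiftingSetoid; DistributiveLawSetoid)

module Modules {ℓ : Level} (V : Quantale ℓ) where
  open Quantale V
  open Over V hiding (TwoFunctor; LiftingSetoid; DistributiveLawSetoid)

  actˡ : ∀ {A B} (R : A ⇝ B) {b b' a} → hom B b' b ⊗ R ⟨ b , a ⟩ ≤ R ⟨ b' , a ⟩
  actˡ {A} {B} R {b} {b'} {a} = begin
    hom B b' b ⊗ R ⟨ b , a ⟩                 ≡⟨ ⊗-comm _ _ ⟩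
    R ⟨ b , a ⟩ ⊗ hom B b' b                 ≡⟨ cong (R ⟨ b , a ⟩ ⊗_) (sym (⊗-unitʳ _)) ⟩
    R ⟨ b , a ⟩ ⊗ (hom B b' b ⊗ I)           ≲⟨ ⊗-monoʳ (⊗-monoʳ (hom-id A a)) ⟩
    R ⟨ b , a ⟩ ⊗ (hom B b' b ⊗ hom A a a)   ≲⟨ uncurry (map-hom R (b , a) (b' , a)) ⟩
    R ⟨ b' , a ⟩                             ∎
    where open ≤-R

  actʳ : ∀ {A B} (R : A ⇝ B) {b a a'} → R ⟨ b , a ⟩ ⊗ hom A a a' ≤ R ⟨ b , a' ⟩
  actʳ {A} {B} R {b} {a} {a'} = begin
    R ⟨ b , a ⟩ ⊗ hom A a a'                 ≡⟨ cong (R ⟨ b , a ⟩ ⊗_) (sym (⊗-unitˡ _)) ⟩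
    R ⟨ b , a ⟩ ⊗ (I ⊗ hom A a a')           ≲⟨ ⊗-monoʳ (⊗-monoˡ (hom-id B b)) ⟩
    R ⟨ b , a ⟩ ⊗ (hom B b b ⊗ hom A a a')   ≲⟨ uncurry (map-hom R (b , a) (b , a')) ⟩
    R ⟨ b , a' ⟩                             ∎
    where open ≤-R

  evalᴸ : ∀ {B} {φ ψ : Psh B} {b} → hom (L B) φ ψ ⊗ map φ b ≤ map ψ b
  evalᴸ {b = b} = ≤-trans (⊗-monoˡ (⋀-lb _ b)) (≤-trans (≡⇒≤ (⊗-comm _ _)) ev)

  ⋁-yoneda : ∀ B (G : Ob B → Carrier) → (∀ {b b'} → G b ⊗ hom B b b' ≤ G b') →
             ∀ b₀ → ⋁ {Ob B} (λ b → G b ⊗ hom B b b₀) ≡ G b₀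
  ⋁-yoneda B G act b₀ = ≤-antisym (⋁-lub _ (λ _ → act)) (begin
    G b₀                   ≡⟨ sym (⊗-unitʳ _) ⟩
    G b₀ ⊗ I               ≲⟨ ⊗-monoʳ (hom-id B b₀) ⟩
    G b₀ ⊗ hom B b₀ b₀     ≲⟨ ⋁-ub (λ b → G b ⊗ hom B b b₀) b₀ ⟩
    ⋁ (λ b → G b ⊗ hom B b b₀) ∎)
    where open ≤-R

  ⋁-yoneda-along : ∀ {A B} (f : VFunctor A B) (φ : Ob A → Carrier) (G : Ob B → Carrier) →
    (∀ {b b'} → hom B b b' ⊗ G b ≤ G b') →
    ⋁ {Ob B} (λ b → ⋁ {Ob A} (λ a → φ a ⊗ hom B b (map f a)) ⊗ G b)
      ≡ ⋁ {Ob A} (λ a → φ a ⊗ G (map f a))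
  ⋁-yoneda-along {A} {B} f φ G act = ≤-antisym
    (⋁-lub _ (λ b → ⋁⊗-lub _ (λ a → begin
      (φ a ⊗ hom B b (map f a)) ⊗ G b   ≡⟨ ⊗-assoc _ _ _ ⟩
      φ a ⊗ (hom B b (map f a) ⊗ G b)   ≲⟨ ⊗-monoʳ act ⟩
      φ a ⊗ G (map f a)                 ≲⟨ ⋁-ub (λ a → φ a ⊗ G (map f a)) a ⟩
      _                                 ∎)))
    (⋁-lub _ (λ a → begin
      φ a ⊗ G (map f a)                             ≡⟨ cong (_⊗ G (map f a)) (sym (⊗-unitʳ _)) ⟩
      (φ a ⊗ I) ⊗ G (map f a)                       ≲⟨ ⊗-monoˡ (⊗-monoʳ (hom-id B (map f a))) ⟩
      (φ a ⊗ hom B (map f a) (map f a)) ⊗ G (map f a)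
        ≲⟨ ⊗-monoˡ (⋁-ub (λ a' → φ a' ⊗ hom B (map f a) (map f a')) a) ⟩
      Lφ (map f a) ⊗ G (map f a)                    ≲⟨ ⋁-ub (λ b → Lφ b ⊗ G b) (map f a) ⟩
      _                                             ∎))
    where
      open ≤-R
      Lφ : Ob B → Carrier
      Lφ b = ⋁ {Ob A} (λ a → φ a ⊗ hom B b (map f a))

  curryₘ : ∀ {A B} → A ⇝ B → VFunctor A (L B)
  curryₘ {A} {B} R = record
    { map = λ a → record
        { map = λ b → R ⟨ b , a ⟩
        ; map-resp = λ p → map-resp R (p , Setoid.refl (Obj A))
        ; map-hom = λ b b' → curry (≤-trans (≡⇒≤ (⊗-comm _ _)) (actˡ R)) }
    ; map-resp = λ q b → map-resp R (Setoid.refl (Obj B) , q)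
    ; map-hom = λ a a' → ⋀-glb _ (λ b → curry (actʳ R)) }

  uncurryₘ : ∀ {A B} → VFunctor A (L B) → A ⇝ B
  uncurryₘ {A} {B} F = record
    { map = λ { (b , a) → map (map F a) b }
    ; map-resp = λ { {b , a} {b' , a'} (p , q) →
        trans (map-resp F q b) (map-resp (map F a') p) }
    ; map-hom = λ { (b , a) (b' , a') → curry (≤-trans
        (⊗-monoʳ (⊗-mono (map-hom (map F a') b b') (≤-trans (map-hom F a a') (⋀-lb _ b))))
        (≤-trans (⊗-monoʳ [,]-comp) ev)) } }

  evalₘ : ∀ A → L A ⇝ A
  evalₘ A = uncurryₘ idF

  curryₘ-cong : ∀ {A B} {R S : A ⇝ B} → R ≐ₘ S → curryₘ R ≐F curryₘ S
  curryₘ-cong e a b = e b a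

  curryₘ-mono : ∀ {A B} {R S : A ⇝ B} → R ≤ₘ S → curryₘ R ≤F curryₘ S
  curryₘ-mono le a = ⋀-glb _ (λ b → curry (≤-trans (≡⇒≤ (⊗-unitʳ _)) (le b a)))

  uncurryₘ-mono : ∀ {A B} {F G : VFunctor A (L B)} → F ≤F G → uncurryₘ F ≤ₘ uncurryₘ G
  uncurryₘ-mono le b a = ≤-trans (≡⇒≤ (sym (⊗-unitʳ _))) (uncurry (≤-trans (le a) (⋀-lb _ b)))

  ∘F-monoʳ : ∀ {A B C} (h : VFunctor B C) {f g : VFunctor A B} → f ≤F g → h ∘F f ≤F h ∘F g
  ∘F-monoʳ h le a = ≤-trans (le a) (map-hom h _ _)

  ·-cong : ∀ {A B C} {S S' : B ⇝ C} {R R' : A ⇝ B} → S ≐ₘ S' → R ≐ₘ R' → S · R ≐ₘ S' · R'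
  ·-cong eS eR c a = ⋁-cong (λ b → cong₂ _⊗_ (eS c b) (eR b a))

  ·-⋄ : ∀ {A B C} (R : B ⇝ C) (f : VFunctor A B) → R · f ⋄ ≐ₘ uncurryₘ (curryₘ R ∘F f)
  ·-⋄ {B = B} R f c a = ⋁-yoneda B (λ b → R ⟨ c , b ⟩) (actʳ R) (map f a)

  evalₘ-·-⋄ : ∀ {A B} (g : VFunctor A (L B)) → evalₘ B · g ⋄ ≐ₘ uncurryₘ g
  evalₘ-·-⋄ {B = B} = ·-⋄ (evalₘ B)

  ⋄-· : ∀ {A B C} (f : VFunctor B C) (R : A ⇝ B) → f ⋄ · R ≐ₘ uncurryₘ (L₁ f ∘F curryₘ R)
  ⋄-· f R c a = ⋁-cong (λ b → ⊗-comm _ _)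

  evalₘ-·-evalₘ : ∀ A → evalₘ A · evalₘ (L A) ≐ₘ uncurryₘ (m A)
  evalₘ-·-evalₘ A a W = ⋁-cong (λ w → ⊗-comm _ _)

  L₁-∘ : ∀ {A B C} (g : VFunctor B C) (f : VFunctor A B) → L₁ (g ∘F f) ≐F L₁ g ∘F L₁ f
  L₁-∘ {C = C} g f φ c = sym (⋁-yoneda-along f (map φ) (λ b → hom C c (map g b))
    (≤-trans (⊗-monoˡ (map-hom g _ _)) (hom-comp C c _ _)))

  uncurryₘ-kleisli : ∀ {A B C} (g : VFunctor B (L C)) (h : VFunctor A (L B)) →
    uncurryₘ (m C ∘F L₁ g ∘F h) ≐ₘ uncurryₘ g · uncurryₘ h
  uncurryₘ-kleisli g h c a = trans
    (⋁-yoneda-along g (map (map h a)) (λ w → map w c) (λ {w} {w'} → evalᴸ {φ = w} {ψ = w'}))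
    (⋁-cong (λ b → ⊗-comm _ _))

  curryₘ-· : ∀ {A B C} (S : B ⇝ C) (R : A ⇝ B) →
    curryₘ (S · R) ≐F m C ∘F L₁ (curryₘ S) ∘F curryₘ R
  curryₘ-· S R a c = sym (uncurryₘ-kleisli (curryₘ S) (curryₘ R) c a)

module Correspondence {ℓ : Level} (V : Quantale ℓ) (T : TwoFunctor V) where
  open Quantale V
  open Over V hiding (TwoFunctor; LiftingSetoid; DistributiveLawSetoid)
  open Over.TwoFunctor T
  open RelationLifting
  open DistributiveLaw
  open Modules V
  open ≡-Reasoning

  module FromLaw (D : DistributiveLaw T) where
    T̄ᴰ : ∀ {A B} → A ⇝ B → F₀ A ⇝ F₀ B
    T̄ᴰ {A} {B} R = uncurryₘ (δ D B ∘F F₁ (curryₘ R))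

    T̄ᴰ-cong : ∀ {A B} {R S : A ⇝ B} → R ≐ₘ S → T̄ᴰ R ≐ₘ T̄ᴰ S
    T̄ᴰ-cong {B = B} {R} {S} e z x =
      map-resp (δ D B) (F-cong {f = curryₘ R} {g = curryₘ S} (curryₘ-cong {R = R} {S = S} e) x) z

    T̄ᴰ-mono : ∀ {A B} {R S : A ⇝ B} → R ≤ₘ S → T̄ᴰ R ≤ₘ T̄ᴰ S
    T̄ᴰ-mono {A} {B} {R} {S} le = uncurryₘ-mono {F = δ D B ∘F F₁ r} {G = δ D B ∘F F₁ s}
      (∘F-monoʳ (δ D B) {F₁ r} {F₁ s} (F-mono {f = r} {g = s} (curryₘ-mono {R = R} {S = S} le)))
      where
        r s : VFunctor A (L B)
        r = curryₘ R
        s = curryₘ S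

    T̄ᴰ-id : ∀ {A} → T̄ᴰ (homM A) ≐ₘ homM (F₀ A)
    T̄ᴰ-id {A} z x =
      trans (map-resp (δ D A) (F-cong {f = curryₘ (homM A)} {g = y A} (λ _ _ → refl) x) z)
            (δ-unit D A x z)

    T̄ᴰ-⋄ : ∀ {A B} (f : VFunctor A B) → T̄ᴰ (f ⋄) ≐ₘ F₁ f ⋄
    T̄ᴰ-⋄ {B = B} f z x =
      trans (map-resp (δ D B) (Setoid.trans (Obj (F₀ (L B)))
              (F-cong {f = curryₘ (f ⋄)} {g = y B ∘F f} (λ _ _ → refl) x) (F-∘ (y B) f x)) z)
            (δ-unit D B (map (F₁ f) x) z)

    T̄ᴰ-· : ∀ {A B C} (S : B ⇝ C) (R : A ⇝ B) → T̄ᴰ (S · R) ≐ₘ T̄ᴰ S · T̄ᴰ R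
    T̄ᴰ-· {A} {B} {C} S R z x = begin
      map (map (δ D C) (map (F₁ (curryₘ (S · R))) x)) z
        ≡⟨ map-resp (δ D C) F₁-curryₘ-· z ⟩
      map (map (δ D C ∘F F₁ (m C)) X) z
        ≡⟨ sym (δ-mult D C X z) ⟩
      map (map (m (F₀ C) ∘F L₁ (δ D C) ∘F δ D (L C) ∘F F₁ (L₁ s)) Y) z
        ≡⟨ map-resp (m (F₀ C) ∘F L₁ (δ D C)) {map (δ D (L C) ∘F F₁ (L₁ s)) Y} {map (L₁ (F₁ s)) φ}
             (δ-nat D s Y) z ⟩
      map (map (m (F₀ C) ∘F L₁ (δ D C) ∘F L₁ (F₁ s)) φ) z
        ≡⟨ map-resp (m (F₀ C)) {map (L₁ (δ D C ∘F F₁ s)) φ} {map (L₁ (δ D C) ∘F L₁ (F₁ s)) φ}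
             (L₁-∘ (δ D C) (F₁ s) φ) z ⟨
      map (map (m (F₀ C) ∘F L₁ (δ D C ∘F F₁ s)) φ) z
        ≡⟨ uncurryₘ-kleisli (δ D C ∘F F₁ s) (δ D B ∘F F₁ r) z x ⟩
      (T̄ᴰ S · T̄ᴰ R) ⟨ z , x ⟩ ∎
      where
        s : VFunctor B (L C)
        s = curryₘ S
        r : VFunctor A (L B)
        r = curryₘ R
        Y : Ob (F₀ (L B))
        Y = map (F₁ r) x
        X : Ob (F₀ (L (L C)))
        X = map (F₁ (L₁ s)) Y
        φ : Psh (F₀ B)
        φ = map (δ D B) Y
        open Setoid (Obj (F₀ (L C))) using () renaming (trans to ≈-trans)
        F₁-curryₘ-· : _≈ₒ_ (F₀ (L C)) (map (F₁ (curryₘ (S · R))) x) (map (F₁ (m C)) X)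
        F₁-curryₘ-· = ≈-trans (F-cong {f = curryₘ (S · R)} {g = m C ∘F L₁ s ∘F r} (curryₘ-· S R) x)
                     (≈-trans (F-∘ (m C) (L₁ s ∘F r) x)
                              (map-resp (F₁ (m C)) (F-∘ (L₁ s) r x)))

    lifting : RelationLifting T
    lifting = record
      { T̄      = T̄ᴰ
      ; T̄-cong = λ {A} {B} {R} {S} → T̄ᴰ-cong {A} {B} {R} {S}
      ; T̄-mono = λ {A} {B} {R} {S} → T̄ᴰ-mono {A} {B} {R} {S}
      ; T̄-id   = T̄ᴰ-id
      ; T̄-·    = T̄ᴰ-·
      ; T̄-⋄    = T̄ᴰ-⋄ }

  module FromLifting (U : RelationLifting T) where
    δᵁ : ∀ A → VFunctor (F₀ (L A)) (L (F₀ A))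
    δᵁ A = curryₘ (T̄ U (evalₘ A))

    T̄-uncurryₘ : ∀ {A B} (g : VFunctor A (L B)) → T̄ U (uncurryₘ g) ≐ₘ uncurryₘ (δᵁ B ∘F F₁ g)
    T̄-uncurryₘ {B = B} g z x = begin
      T̄ U (uncurryₘ g) ⟨ z , x ⟩
        ≡⟨ T̄-cong U {R = evalₘ B · g ⋄} {S = uncurryₘ g} (evalₘ-·-⋄ g) z x ⟨
      T̄ U (evalₘ B · g ⋄) ⟨ z , x ⟩
        ≡⟨ T̄-· U (evalₘ B) (g ⋄) z x ⟩
      (T̄ U (evalₘ B) · T̄ U (g ⋄)) ⟨ z , x ⟩
        ≡⟨ ·-cong {S = T̄ U (evalₘ B)} {T̄ U (evalₘ B)} {T̄ U (g ⋄)} {F₁ g ⋄}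
             (λ _ _ → refl) (T̄-⋄ U g) z x ⟩
      (T̄ U (evalₘ B) · F₁ g ⋄) ⟨ z , x ⟩
        ≡⟨ ·-⋄ (T̄ U (evalₘ B)) (F₁ g) z x ⟩
      uncurryₘ (δᵁ B ∘F F₁ g) ⟨ z , x ⟩ ∎

    δᵁ-unit : ∀ A → δᵁ A ∘F F₁ (y A) ≐F y (F₀ A)
    δᵁ-unit A x z = begin
      uncurryₘ (δᵁ A ∘F F₁ (y A)) ⟨ z , x ⟩
        ≡⟨ T̄-uncurryₘ (y A) z x ⟨
      T̄ U (uncurryₘ (y A)) ⟨ z , x ⟩
        ≡⟨ T̄-cong U {R = uncurryₘ (y A)} {S = homM A} (λ _ _ → refl) z x ⟩
      T̄ U (homM A) ⟨ z , x ⟩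
        ≡⟨ T̄-id U z x ⟩
      hom (F₀ A) z x ∎

    δᵁ-nat : ∀ {A B} (f : VFunctor A B) → δᵁ B ∘F F₁ (L₁ f) ≐F L₁ (F₁ f) ∘F δᵁ A
    δᵁ-nat {A} {B} f X z = begin
      uncurryₘ (δᵁ B ∘F F₁ (L₁ f)) ⟨ z , X ⟩
        ≡⟨ T̄-uncurryₘ (L₁ f) z X ⟨
      T̄ U (uncurryₘ (L₁ f)) ⟨ z , X ⟩
        ≡⟨ T̄-cong U {R = f ⋄ · evalₘ A} {S = uncurryₘ (L₁ f)} (⋄-· f (evalₘ A)) z X ⟨
      T̄ U (f ⋄ · evalₘ A) ⟨ z , X ⟩
        ≡⟨ T̄-· U (f ⋄) (evalₘ A) z X ⟩
      (T̄ U (f ⋄) · T̄ U (evalₘ A)) ⟨ z , X ⟩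
        ≡⟨ ·-cong {S = T̄ U (f ⋄)} {F₁ f ⋄} {T̄ U (evalₘ A)} {T̄ U (evalₘ A)}
             (T̄-⋄ U f) (λ _ _ → refl) z X ⟩
      (F₁ f ⋄ · T̄ U (evalₘ A)) ⟨ z , X ⟩
        ≡⟨ ⋄-· (F₁ f) (T̄ U (evalₘ A)) z X ⟩
      uncurryₘ (L₁ (F₁ f) ∘F δᵁ A) ⟨ z , X ⟩ ∎

    δᵁ-mult : ∀ A → m (F₀ A) ∘F L₁ (δᵁ A) ∘F δᵁ (L A) ≐F δᵁ A ∘F F₁ (m A)
    δᵁ-mult A X z = begin
      uncurryₘ (m (F₀ A) ∘F L₁ (δᵁ A) ∘F δᵁ (L A)) ⟨ z , X ⟩
        ≡⟨ uncurryₘ-kleisli (δᵁ A) (δᵁ (L A)) z X ⟩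
      (T̄ U (evalₘ A) · T̄ U (evalₘ (L A))) ⟨ z , X ⟩
        ≡⟨ T̄-· U (evalₘ A) (evalₘ (L A)) z X ⟨
      T̄ U (evalₘ A · evalₘ (L A)) ⟨ z , X ⟩
        ≡⟨ T̄-cong U {R = evalₘ A · evalₘ (L A)} {S = uncurryₘ (m A)} (evalₘ-·-evalₘ A) z X ⟩
      T̄ U (uncurryₘ (m A)) ⟨ z , X ⟩
        ≡⟨ T̄-uncurryₘ (m A) z X ⟩
      uncurryₘ (δᵁ A ∘F F₁ (m A)) ⟨ z , X ⟩ ∎

    law : DistributiveLaw T
    law = record { δ = δᵁ ; δ-nat = δᵁ-nat ; δ-unit = δᵁ-unit ; δ-mult = δᵁ-mult }

  open FromLaw using (lifting)
  open FromLifting using (law)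
  open Setoid (LiftingSetoid V T) using () renaming (_≈_ to _≈ᴸ_)
  open Setoid (DistributiveLawSetoid V T) using () renaming (_≈_ to _≈ᴰ_)

  lifting-law : ∀ U → lifting (law U) ≈ᴸ U
  lifting-law U {B = B} R z x = begin
    uncurryₘ (δᵁ B ∘F F₁ (curryₘ R)) ⟨ z , x ⟩
      ≡⟨ T̄-uncurryₘ (curryₘ R) z x ⟨
    T̄ U (uncurryₘ (curryₘ R)) ⟨ z , x ⟩
      ≡⟨ T̄-cong U {R = uncurryₘ (curryₘ R)} {S = R} (λ _ _ → refl) z x ⟩
    T̄ U R ⟨ z , x ⟩ ∎
    where open FromLifting U

  law-lifting : ∀ D → law (lifting D) ≈ᴰ D
  law-lifting D A X = map-resp (δ D A) (Setoid.trans (Obj (F₀ (L A)))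
    (F-cong {f = curryₘ (evalₘ A)} {g = idF} (λ _ _ → refl) X) (F-id X))

  law-cong : ∀ U U' → U ≈ᴸ U' → law U ≈ᴰ law U'
  law-cong U U' e A X z = e (evalₘ A) z X

  lifting-cong : ∀ D D' → D ≈ᴰ D' → lifting D ≈ᴸ lifting D'
  lifting-cong D D' e R z x = e _ (map (F₁ (curryₘ R)) x) z

  law-inverseˡ : ∀ D U → U ≈ᴸ lifting D → law U ≈ᴰ D
  law-inverseˡ D U e A X z = trans (law-cong U (lifting D) e A X z) (law-lifting D A X z)

  law-inverseʳ : ∀ U D → D ≈ᴰ law U → lifting D ≈ᴸ U
  law-inverseʳ U D e R z x = trans (lifting-cong D (law U) e R z x) (lifting-law U R z x)

  liftings↔laws : Inverse (LiftingSetoid V T) (DistributiveLawSetoid V T)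
  liftings↔laws = record
    { to = law
    ; from = lifting
    ; to-cong = λ {U} {U'} → law-cong U U'
    ; from-cong = λ {D} {D'} → lifting-cong D D'
    ; inverse = (λ {D} {U} → law-inverseˡ D U) , (λ {U} {D} → law-inverseʳ U D) }

corollary3p14 : ∀ {ℓ : Level} (V : Quantale ℓ) (T : TwoFunctor V) →
    Inverse (LiftingSetoid V T) (DistributiveLawSetoid V T)
corollary3p14 = Correspondence.liftings↔laws
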